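{- Let $k\geq4$ and let $r_1,\dots,r_s$ be positive integers with $\sum_{i=1}^s r_i=k-1$. Then $\operatorname{ex}(K^*_{k-1}(r_1,\dots,r_s),P_3)\geq k-1$, with equality if either $r_i=1$ for all $i$, or $3\nmid k$ and $r_1=k-1$. Consequently $\mathcal{E}_{P_3}(k)\geq\binom{k}{2}$.
   Context: $P_3$ is the path with 3 edges. For positive integers $m, r_1,\dots,r_s$ with $\sum r_i=m$, the pendant graph $K^*_m(r_1,\dots,r_s)$ is obtained from a clique on the core vertices $\{v_1,\dots,v_m\}$ by adding pendant vertices $w_1,\dots,w_s$, partitioning the core into sets $W_1,\dots,W_s$ with $|W_i|=r_i$, and joining $w_i$ to every vertex of $W_i$; it has $\binom{m+1}{2}$ edges. $\operatorname{ex}(G,H)$ is the maximum number of edges of an $H$-free subgraph of $G$, and $\mathcal{E}_H(k):=\sup\{e(G): G \text{ simple}, \operatorname{ex}(G,H)<k\}$. -}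

module Defs where

open import Data.Bool using (Bool; true; false; _∧_; T)
open import Data.Nat using (ℕ; zero; suc; _+_; _<ᵇ_; _≤_; _<_)
open import Data.Fin using (Fin; toℕ; splitAt; _≟_)
open import Data.List using (List; map; allFin)
open import Data.Nat.ListAction using (sum)
open import Data.Sum using (_⊎_; inj₁; inj₂)
open import Data.Product using (Σ; _×_; _,_; ∃-syntax)
open import Relation.Nullary using (¬_; yes; no)
open import Relation.Nullary.Decidable using (⌊_⌋)
open import Relation.Binary.PropositionalEquality using (_≡_; refl)

record Graph (n : ℕ) : Set where
  field
    adj    : Fin n → Fin n → Bool
    sym    : ∀ i j → adj i j ≡ adj j i
    irrefl : ∀ i → adj i i ≡ false
open Graph public

Σ[_]_ : (n : ℕ) → (Fin n → ℕ) → ℕ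
Σ[ n ] f = sum (map f (allFin n))

edges : ∀ {n} → Graph n → ℕ
edges {n} G = Σ[ n ] λ i → Σ[ n ] λ j →
  Data.Bool.if (toℕ i <ᵇ toℕ j) ∧ adj G i j then 1 else 0

_⊑_ : ∀ {n} → Graph n → Graph n → Set
H ⊑ G = ∀ i j → T (adj H i j) → T (adj G i j)

HasP3 : ∀ {n} → Graph n → Set
HasP3 {n} H = Σ (Fin n) λ a → Σ (Fin n) λ b → Σ (Fin n) λ c → Σ (Fin n) λ d →
  (¬ a ≡ b × ¬ a ≡ c × ¬ a ≡ d × ¬ b ≡ c × ¬ b ≡ d × ¬ c ≡ d) ×
  (T (adj H a b) × T (adj H b c) × T (adj H c d))

P3Free : ∀ {n} → Graph n → Set
P3Free H = ¬ HasP3 H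

ExP3≥ : ∀ {n} → Graph n → ℕ → Set
ExP3≥ G t = Σ _ λ H → H ⊑ G × P3Free H × t ≤ edges H

ExP3≤ : ∀ {n} → Graph n → ℕ → Set
ExP3≤ G t = ∀ H → H ⊑ G → P3Free H → edges H ≤ t

ExP3≡ : ∀ {n} → Graph n → ℕ → Set
ExP3≡ G t = ExP3≥ G t × ExP3≤ G t

fiberSize : ∀ {m s} → (Fin m → Fin s) → Fin s → ℕ
fiberSize {m} f i = Σ[ m ] λ j → Data.Bool.if ⌊ f j ≟ i ⌋ then 1 else 0

-- Pendant graph K*_m(r₁,…,r_s).  Vertices Fin (m + s): the first m are the
-- core v₁…v_m (a clique), the last s are the pendant vertices w₁…w_s.
-- The partition of the core into W₁,…,W_s is given by f : core vertex j lies
-- in W_{f j}; pendant w_i is joined to every vertex of W_i.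
private
  pAdj : ∀ {m s} → (Fin m → Fin s) → Fin m ⊎ Fin s → Fin m ⊎ Fin s → Bool
  pAdj f (inj₁ a) (inj₁ b) = Data.Bool.not ⌊ a ≟ b ⌋
  pAdj f (inj₁ a) (inj₂ i) = ⌊ f a ≟ i ⌋
  pAdj f (inj₂ i) (inj₁ a) = ⌊ f a ≟ i ⌋
  pAdj f (inj₂ i) (inj₂ j) = false

  ≟-sym : ∀ {n} (a b : Fin n) → ⌊ a ≟ b ⌋ ≡ ⌊ b ≟ a ⌋
  ≟-sym a b with a ≟ b | b ≟ a
  ... | yes _ | yes _ = refl
  ... | no _  | no _  = refl
  ... | yes refl | no q = Data.Empty.⊥-elim (q refl)
    where import Data.Empty
  ... | no p  | yes refl = Data.Empty.⊥-elim (p refl)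
    where import Data.Empty

  ≟-refl : ∀ {n} (a : Fin n) → ⌊ a ≟ a ⌋ ≡ true
  ≟-refl a with a ≟ a
  ... | yes _ = refl
  ... | no p = Data.Empty.⊥-elim (p refl)
    where import Data.Empty

  pSym : ∀ {m s} (f : Fin m → Fin s) x y → pAdj f x y ≡ pAdj f y x
  pSym f (inj₁ a) (inj₁ b) rewrite ≟-sym a b = refl
  pSym f (inj₁ a) (inj₂ i) = refl
  pSym f (inj₂ i) (inj₁ a) = refl
  pSym f (inj₂ i) (inj₂ j) = refl

  pIrr : ∀ {m s} (f : Fin m → Fin s) x → pAdj f x x ≡ false
  pIrr f (inj₁ a) rewrite ≟-refl a = refl
  pIrr f (inj₂ i) = refl

Pendant : (m s : ℕ) → (Fin m → Fin s) → Graph (m + s)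
Pendant m s f = record
  { adj    = λ x y → pAdj f (splitAt m x) (splitAt m y)
  ; sym    = λ x y → pSym f (splitAt m x) (splitAt m y)
  ; irrefl = λ x → pIrr f (splitAt m x)
  }

-- A P3-free graph is a disjoint union of triangles and stars.  Give every edge weight 2 and
-- split it between its endpoints: a leaf of a star takes all of it, the two ends of an isolated
-- edge or of a triangle edge take 1 each.  Then no vertex receives more than 2, so a P3-free
-- graph has at most as many edges as vertices, and if every vertex received exactly 2 every
-- vertex would lie in a triangle, forcing 3 ∣ n.  In K*_{k-1}(1,…,1) each pendant vertex can
-- only be a leaf attached to its own core vertex, and such a pair receives at most 2 in total,
-- so a P3-free subgraph has at most k-1 edges; K*_{k-1}(k-1) is K_k, where 3 ∤ k gives the
-- same bound.  The star at a core vertex has k-1 edges, and K*_{k-1}(1,…,1) has binom(k,2).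
module Submission where

open import Data.Bool using (Bool; true; false; T; not; if_then_else_; _∧_; _∨_)
open import Data.Bool.Properties using (∧-zeroʳ; ∨-comm; T-∧; T-∨)
open import Data.Empty using (⊥; ⊥-elim)
open import Data.Fin using (Fin; zero; suc; toℕ; _↑ˡ_; _↑ʳ_; _≟_; splitAt)
open import Data.Fin.Properties
  using (suc-injective; toℕ-injective; any?; all?; ¬∀⟶∃¬; splitAt-↑ˡ; splitAt-↑ʳ; splitAt⁻¹-↑ˡ)
open import Data.List using (tabulate)
open import Data.List.Properties using (map-tabulate)
open import Data.Nat using (ℕ; zero; suc; _+_; _*_; _∸_; _≤_; _<_; z≤n; s≤s; _<ᵇ_)
  renaming (_≟_ to _≟ℕ_)
open import Data.Nat.Combinatorics using (_C_; nCk+nC[k+1]≡[n+1]C[k+1]; nC1≡n)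
open import Data.Nat.Divisibility using (_∣_; divides)
import Data.Nat.ListAction as List
open import Data.Nat.Properties hiding (suc-injective; _≟_)
open import Data.Nat.Solver using (module +-*-Solver)
open import Data.Product using (Σ; ∃; ∃₂; ∃-syntax; _×_; _,_; proj₁; proj₂)
open import Data.Sum using (_⊎_; inj₁; inj₂; [_,_]′)
open import Data.Unit using (tt)
open import Defs hiding (sym)
open import Function using (_∘_; id)
open import Function.Bundles using (Equivalence)
open import Function.Definitions using (Injective)
open import Relation.Binary.PropositionalEquality
open import Relation.Nullary using (¬_; contradiction; Dec; yes; no; does)
open import Relation.Nullary.Decidable
  using (⌊_⌋; isYes≗does; toWitness; dec-true; dec-false; T?; _×-dec_; _→-dec_; ¬?)

open import Algebra.Properties.CommutativeMonoid.Sum +-0-commutativeMonoid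
  using (sum; sum-cong-≗; sum-syntax)
open import Algebra.Properties.CommutativeSemigroup +-commutativeSemigroup
  using () renaming (interchange to +-interchange)
open +-*-Solver using (solve; _:+_; _:*_; _:=_; con)

𝟙 : Bool → ℕ
𝟙 b = if b then 1 else 0

𝟙-not+𝟙 : ∀ b → 𝟙 (not b) + 𝟙 b ≡ 1
𝟙-not+𝟙 false = refl
𝟙-not+𝟙 true  = refl

𝟙+𝟙-not : ∀ a b → 𝟙 b + 𝟙 (not a) + (𝟙 a + 𝟙 (not b)) ≡ 2
𝟙+𝟙-not false false = refl
𝟙+𝟙-not false true  = refl
𝟙+𝟙-not true  false = refl
𝟙+𝟙-not true  true  = refl

𝟙+𝟙≤2 : ∀ a b → 𝟙 a + 𝟙 b ≤ 2
𝟙+𝟙≤2 false false = z≤n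
𝟙+𝟙≤2 false true  = s≤s z≤n
𝟙+𝟙≤2 true  false = s≤s z≤n
𝟙+𝟙≤2 true  true  = ≤-refl

⌊⌋-true : ∀ {A : Set} (a? : Dec A) → A → ⌊ a? ⌋ ≡ true
⌊⌋-true a? a = trans (isYes≗does a?) (dec-true a? a)

⌊⌋-false : ∀ {A : Set} (a? : Dec A) → ¬ A → ⌊ a? ⌋ ≡ false
⌊⌋-false a? ¬a = trans (isYes≗does a?) (dec-false a? ¬a)

Σ≡∑ : ∀ n (f : Fin n → ℕ) → Σ[ n ] f ≡ ∑[ i < n ] f i
Σ≡∑ n f = trans (cong List.sum (map-tabulate (λ i → i) f)) (sum-tabulate n f)
  where
  sum-tabulate : ∀ n (f : Fin n → ℕ) → List.sum (tabulate f) ≡ sum f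
  sum-tabulate zero    f = refl
  sum-tabulate (suc n) f = cong (f zero +_) (sum-tabulate n (f ∘ suc))

sum-distrib-+ : ∀ {n} (f g : Fin n → ℕ) → ∑[ i < n ] (f i + g i) ≡ sum f + sum g
sum-distrib-+ {zero}  f g = refl
sum-distrib-+ {suc n} f g =
  trans (cong (f zero + g zero +_) (sum-distrib-+ (f ∘ suc) (g ∘ suc)))
        (+-interchange (f zero) (g zero) (sum (f ∘ suc)) (sum (g ∘ suc)))

sum-distribˡ-* : ∀ {n} k (f : Fin n → ℕ) → ∑[ i < n ] (k * f i) ≡ k * sum f
sum-distribˡ-* {zero}  k f = sym (*-zeroʳ k)
sum-distribˡ-* {suc n} k f =
  trans (cong (k * f zero +_) (sum-distribˡ-* k (f ∘ suc))) (sym (*-distribˡ-+ k (f zero) _))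

sum-const : ∀ n c → ∑[ i < n ] c ≡ n * c
sum-const zero    c = refl
sum-const (suc n) c = cong (c +_) (sum-const n c)

sum-zero : ∀ {n} {f : Fin n → ℕ} → (∀ i → f i ≡ 0) → sum f ≡ 0
sum-zero {zero}  f≡0 = refl
sum-zero {suc n} f≡0 = cong₂ _+_ (f≡0 zero) (sum-zero (f≡0 ∘ suc))

sum-mono-≤ : ∀ {n} {f g : Fin n → ℕ} → (∀ i → f i ≤ g i) → sum f ≤ sum g
sum-mono-≤ {zero}  f≤g = z≤n
sum-mono-≤ {suc n} f≤g = +-mono-≤ (f≤g zero) (sum-mono-≤ (f≤g ∘ suc))

sum-swap : ∀ {m n} (f : Fin m → Fin n → ℕ) →
           ∑[ i < m ] ∑[ j < n ] f i j ≡ ∑[ j < n ] ∑[ i < m ] f i j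
sum-swap {zero} {n} f = sym (sum-zero {n} (λ _ → refl))
sum-swap {suc m} f = trans (cong (sum (f zero) +_) (sum-swap (f ∘ suc)))
                           (sym (sum-distrib-+ (f zero) _))

sum-↑ : ∀ m {n} (f : Fin (m + n) → ℕ) →
        sum f ≡ ∑[ i < m ] f (i ↑ˡ n) + ∑[ j < n ] f (m ↑ʳ j)
sum-↑ zero    f = refl
sum-↑ (suc m) f = trans (cong (f zero +_) (sum-↑ m (f ∘ suc))) (sym (+-assoc (f zero) _ _))

sum-single : ∀ {n} {f : Fin n → ℕ} p → (∀ i → i ≢ p → f i ≡ 0) → sum f ≡ f p
sum-single {suc n} {f} zero    f≡0 =
  trans (cong (f zero +_) (sum-zero (λ i → f≡0 (suc i) λ ()))) (+-identityʳ (f zero))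
sum-single {suc n} {f} (suc p) f≡0 =
  cong₂ _+_ (f≡0 zero λ ()) (sum-single p (λ i i≢p → f≡0 (suc i) (i≢p ∘ suc-injective)))

sum-pair : ∀ {n} {f : Fin n → ℕ} {p q} → p ≢ q → (∀ i → i ≢ p → i ≢ q → f i ≡ 0) →
           sum f ≡ f p + f q
sum-pair {suc n} {f} {zero}  {zero}  p≢q f≡0 = contradiction refl p≢q
sum-pair {suc n} {f} {zero}  {suc q} p≢q f≡0 =
  cong (f zero +_) (sum-single q (λ i i≢q → f≡0 (suc i) (λ ()) (i≢q ∘ suc-injective)))
sum-pair {suc n} {f} {suc p} {zero}  p≢q f≡0 =
  trans (cong (f zero +_) (sum-single p (λ i i≢p → f≡0 (suc i) (i≢p ∘ suc-injective) (λ ()))))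
        (+-comm (f zero) (f (suc p)))
sum-pair {suc n} {f} {suc p} {suc q} p≢q f≡0 =
  cong₂ _+_ (f≡0 zero (λ ()) (λ ()))
            (sum-pair (p≢q ∘ cong suc) (λ i i≢p i≢q →
              f≡0 (suc i) (i≢p ∘ suc-injective) (i≢q ∘ suc-injective)))

term≤sum : ∀ {n} (f : Fin n → ℕ) p → f p ≤ sum f
term≤sum f zero    = m≤m+n (f zero) _
term≤sum f (suc p) = ≤-trans (term≤sum (f ∘ suc) p) (m≤n+m _ (f zero))

pair≤sum : ∀ {n} (f : Fin n → ℕ) {p q} → p ≢ q → f p + f q ≤ sum f
pair≤sum f {zero}  {zero}  p≢q = contradiction refl p≢q
pair≤sum f {zero}  {suc q} p≢q = +-monoʳ-≤ (f zero) (term≤sum (f ∘ suc) q)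
pair≤sum f {suc p} {zero}  p≢q =
  subst (_≤ sum f) (+-comm (f zero) (f (suc p))) (+-monoʳ-≤ (f zero) (term≤sum (f ∘ suc) p))
pair≤sum f {suc p} {suc q} p≢q = ≤-trans (pair≤sum (f ∘ suc) (p≢q ∘ cong suc)) (m≤n+m _ (f zero))

sum<bound : ∀ {n} {f : Fin n → ℕ} {b} p → (∀ i → f i ≤ b) → f p < b → sum f < n * b
sum<bound {suc n} {b = b} zero f≤b fp<b =
  +-mono-<-≤ fp<b (≤-trans (sum-mono-≤ (f≤b ∘ suc)) (≤-reflexive (sum-const n b)))
sum<bound (suc p) f≤b fp<b = +-mono-≤-< (f≤b zero) (sum<bound p (f≤b ∘ suc) fp<b)

sum-𝟙-≟ˡ : ∀ {n} (a : Fin n) → ∑[ i < n ] 𝟙 ⌊ i ≟ a ⌋ ≡ 1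
sum-𝟙-≟ˡ a =
  trans (sum-single a (λ i i≢a → cong 𝟙 (⌊⌋-false (i ≟ a) i≢a))) (cong 𝟙 (⌊⌋-true (a ≟ a) refl))

sum-𝟙-≟ʳ : ∀ {n} (a : Fin n) → ∑[ i < n ] 𝟙 ⌊ a ≟ i ⌋ ≡ 1
sum-𝟙-≟ʳ a =
  trans (sum-single a (λ i i≢a → cong 𝟙 (⌊⌋-false (a ≟ i) (i≢a ∘ sym)))) (cong 𝟙 (⌊⌋-true (a ≟ a) refl))

degree : ∀ {n} → Graph n → Fin n → ℕ
degree {n} G v = ∑[ u < n ] 𝟙 (adj G v u)

if<ᵇ+if>ᵇ : ∀ a b (x : ℕ) → (a ≡ b → x ≡ 0) →
            (if a <ᵇ b then x else 0) + (if b <ᵇ a then x else 0) ≡ x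
if<ᵇ+if>ᵇ zero    zero    x x≡0 = sym (x≡0 refl)
if<ᵇ+if>ᵇ zero    (suc b) x x≡0 = +-identityʳ x
if<ᵇ+if>ᵇ (suc a) zero    x x≡0 = refl
if<ᵇ+if>ᵇ (suc a) (suc b) x x≡0 = if<ᵇ+if>ᵇ a b x (x≡0 ∘ cong suc)

sum-upper+lower : ∀ {n} (g : Fin n → Fin n → ℕ) → (∀ i → g i i ≡ 0) →
  ∑[ i < n ] ∑[ j < n ] (if toℕ i <ᵇ toℕ j then g i j else 0) +
  ∑[ i < n ] ∑[ j < n ] (if toℕ i <ᵇ toℕ j then g j i else 0) ≡ ∑[ i < n ] ∑[ j < n ] g i j
sum-upper+lower {n} g g-diag = begin
  ∑[ i < n ] ∑[ j < n ] upper i j + ∑[ i < n ] ∑[ j < n ] (if toℕ i <ᵇ toℕ j then g j i else 0)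
    ≡⟨ cong (∑[ i < n ] ∑[ j < n ] upper i j +_)
            (sum-swap (λ i j → if toℕ i <ᵇ toℕ j then g j i else 0)) ⟩
  ∑[ i < n ] ∑[ j < n ] upper i j + ∑[ i < n ] ∑[ j < n ] lower i j
    ≡⟨ sym (sum-distrib-+ (sum ∘ upper) (sum ∘ lower)) ⟩
  ∑[ i < n ] (∑[ j < n ] upper i j + ∑[ j < n ] lower i j)
    ≡⟨ sum-cong-≗ (λ i → sym (sum-distrib-+ (upper i) (lower i))) ⟩
  ∑[ i < n ] ∑[ j < n ] (upper i j + lower i j)
    ≡⟨ sum-cong-≗ (λ i → sum-cong-≗ (λ j → if<ᵇ+if>ᵇ (toℕ i) (toℕ j) (g i j) (λ i≡j →
         subst (λ j → g i j ≡ 0) (toℕ-injective i≡j) (g-diag i)))) ⟩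
  ∑[ i < n ] ∑[ j < n ] g i j ∎
  where
  open ≡-Reasoning
  upper lower : Fin n → Fin n → ℕ
  upper i j = if toℕ i <ᵇ toℕ j then g i j else 0
  lower i j = if toℕ j <ᵇ toℕ i then g i j else 0

module _ {n} (G : Graph n) where

  2*edges≡∑shares : (c : Fin n → Fin n → ℕ) → (∀ i j → T (adj G i j) → c i j + c j i ≡ 2) →
    2 * edges G ≡ ∑[ i < n ] ∑[ j < n ] (if adj G i j then c i j else 0)
  2*edges≡∑shares c c-sum = begin
    2 * edges G
      ≡⟨ cong (2 *_) (trans (Σ≡∑ n _) (sum-cong-≗ (λ i → Σ≡∑ n (edge i)))) ⟩
    2 * ∑[ i < n ] ∑[ j < n ] edge i j
      ≡⟨ sym (trans (sum-cong-≗ (λ i → sum-distribˡ-* 2 (edge i))) (sum-distribˡ-* 2 (sum ∘ edge))) ⟩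
    ∑[ i < n ] ∑[ j < n ] (2 * edge i j)
      ≡⟨ sum-cong-≗ (λ i → sum-cong-≗ (λ j → double-edge i j)) ⟩
    ∑[ i < n ] ∑[ j < n ] (upper i j + lower i j)
      ≡⟨ trans (sum-cong-≗ (λ i → sum-distrib-+ (upper i) (lower i)))
               (sum-distrib-+ (sum ∘ upper) (sum ∘ lower)) ⟩
    ∑[ i < n ] ∑[ j < n ] upper i j + ∑[ i < n ] ∑[ j < n ] lower i j
      ≡⟨ sum-upper+lower w (λ i → cong (λ b → if b then c i i else 0) (irrefl G i)) ⟩
    ∑[ i < n ] ∑[ j < n ] w i j ∎
    where
    open ≡-Reasoning
    edge w upper lower : Fin n → Fin n → ℕ
    edge i j = if (toℕ i <ᵇ toℕ j) ∧ adj G i j then 1 else 0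
    w i j = if adj G i j then c i j else 0
    upper i j = if toℕ i <ᵇ toℕ j then w i j else 0
    lower i j = if toℕ i <ᵇ toℕ j then w j i else 0

    shares : ∀ i j → 2 * 𝟙 (adj G i j) ≡ w i j + w j i
    shares i j rewrite Graph.sym G j i with adj G i j in a
    ... | false = refl
    ... | true  = sym (c-sum i j (subst T (sym a) tt))

    double-edge : ∀ i j → 2 * edge i j ≡ upper i j + lower i j
    double-edge i j with toℕ i <ᵇ toℕ j
    ... | false = refl
    ... | true  = shares i j

  handshake : 2 * edges G ≡ ∑[ v < n ] degree G v
  handshake = 2*edges≡∑shares (λ _ _ → 1) (λ _ _ _ → refl)

module Neighbourhood {n} (G : Graph n) where

  Adj : Fin n → Fin n → Set
  Adj v u = T (adj G v u)

  Adj-sym : ∀ {v u} → Adj v u → Adj u v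
  Adj-sym {v} {u} = subst T (Graph.sym G v u)

  Adj⇒≢ : ∀ {v u} → Adj v u → v ≢ u
  Adj⇒≢ {v} v~u refl = subst T (irrefl G v) v~u

  adj≡true : ∀ {v u} → Adj v u → adj G v u ≡ true
  adj≡true {v} {u} = dec-true (T? (adj G v u))

  adj≡false : ∀ {v u} → ¬ Adj v u → adj G v u ≡ false
  adj≡false {v} {u} = dec-false (T? (adj G v u))

  degree-sym : ∀ u → ∑[ v < n ] 𝟙 (adj G v u) ≡ degree G u
  degree-sym u = sum-cong-≗ (λ v → cong 𝟙 (Graph.sym G v u))

  OnlyNeighbour : Fin n → Fin n → Set
  OnlyNeighbour v u = ∀ t → Adj v t → t ≡ u

  HasOtherNeighbour : Fin n → Fin n → Set
  HasOtherNeighbour v u = ∃ λ w → Adj v w × w ≢ u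

  hasOtherNeighbour? : ∀ v u → Dec (HasOtherNeighbour v u)
  hasOtherNeighbour? v u = any? (λ w → T? (adj G v w) ×-dec ¬? (w ≟ u))

  ¬HasOther⇒Only : ∀ {v u} → ¬ HasOtherNeighbour v u → OnlyNeighbour v u
  ¬HasOther⇒Only {v} {u} ¬other t v~t with t ≟ u
  ... | yes t≡u = t≡u
  ... | no  t≢u = contradiction (t , v~t , t≢u) ¬other

  NeighbourhoodIs : Fin n → Fin n → Fin n → Set
  NeighbourhoodIs v p q = p ≢ q × Adj v p × Adj v q × (∀ t → Adj v t → t ≡ p ⊎ t ≡ q)

  InTriangle : Fin n → Set
  InTriangle v = ∃₂ λ p q → NeighbourhoodIs v p q × Adj p q

  degree-neighbourhood : ∀ {v p q} → NeighbourhoodIs v p q → degree G v ≡ 2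
  degree-neighbourhood (p≢q , v~p , v~q , N⊆pq) =
    trans (sum-pair p≢q (λ t t≢p t≢q → cong 𝟙 (adj≡false (λ v~t → [ t≢p , t≢q ]′ (N⊆pq t v~t)))))
          (cong₂ _+_ (cong 𝟙 (adj≡true v~p)) (cong 𝟙 (adj≡true v~q)))

  neighbourhood-reorder : ∀ {v p q a b} → NeighbourhoodIs v p q → Adj v a → Adj v b → a ≢ b →
                          NeighbourhoodIs v a b
  neighbourhood-reorder {v} {a = a} {b} (_ , _ , _ , N⊆pq) v~a v~b a≢b = a≢b , v~a , v~b , N⊆ab
    where
    N⊆ab : ∀ t → Adj v t → t ≡ a ⊎ t ≡ b
    N⊆ab t v~t with N⊆pq t v~t | N⊆pq a v~a | N⊆pq b v~b
    ... | inj₁ refl | inj₁ refl | _         = inj₁ refl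
    ... | inj₁ refl | inj₂ refl | inj₁ refl = inj₂ refl
    ... | inj₁ refl | inj₂ refl | inj₂ refl = contradiction refl a≢b
    ... | inj₂ refl | inj₂ refl | _         = inj₁ refl
    ... | inj₂ refl | inj₁ refl | inj₂ refl = inj₂ refl
    ... | inj₂ refl | inj₁ refl | inj₁ refl = contradiction refl a≢b

  IsLocalMin : Fin n → Set
  IsLocalMin v = ∀ t → Adj v t → T (toℕ v <ᵇ toℕ t)

  isLocalMin? : ∀ v → Dec (IsLocalMin v)
  isLocalMin? v = all? (λ t → T? (adj G v t) →-dec T? (toℕ v <ᵇ toℕ t))

  isLocalMin-neighbourhood : ∀ {v p q} → NeighbourhoodIs v p q →
    does (isLocalMin? v) ≡ (toℕ v <ᵇ toℕ p) ∧ (toℕ v <ᵇ toℕ q)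
  isLocalMin-neighbourhood {v} {p} {q} (_ , v~p , v~q , N⊆pq)
    with toℕ v <ᵇ toℕ p in v<p | toℕ v <ᵇ toℕ q in v<q
  ... | false | _     = dec-false (isLocalMin? v) (λ min → subst T v<p (min p v~p))
  ... | true  | false = dec-false (isLocalMin? v) (λ min → subst T v<q (min q v~q))
  ... | true  | true  = dec-true (isLocalMin? v) min
    where
    min : IsLocalMin v
    min t v~t with N⊆pq t v~t
    ... | inj₁ refl = subst T (sym v<p) tt
    ... | inj₂ refl = subst T (sym v<q) tt

exactly-one-minimum : ∀ a b c → a ≢ b → b ≢ c → a ≢ c →
  𝟙 ((a <ᵇ b) ∧ (a <ᵇ c)) + (𝟙 ((b <ᵇ a) ∧ (b <ᵇ c)) + 𝟙 ((c <ᵇ a) ∧ (c <ᵇ b))) ≡ 1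
exactly-one-minimum zero    zero    c       a≢b b≢c a≢c = contradiction refl a≢b
exactly-one-minimum zero    (suc b) zero    a≢b b≢c a≢c = contradiction refl a≢c
exactly-one-minimum zero    (suc b) (suc c) a≢b b≢c a≢c = refl
exactly-one-minimum (suc a) zero    zero    a≢b b≢c a≢c = contradiction refl b≢c
exactly-one-minimum (suc a) zero    (suc c) a≢b b≢c a≢c rewrite ∧-zeroʳ (c <ᵇ a) = refl
exactly-one-minimum (suc a) (suc b) zero    a≢b b≢c a≢c
  rewrite ∧-zeroʳ (a <ᵇ b) | ∧-zeroʳ (b <ᵇ a) = refl
exactly-one-minimum (suc a) (suc b) (suc c) a≢b b≢c a≢c =
  exactly-one-minimum a b c (a≢b ∘ cong suc) (b≢c ∘ cong suc) (a≢c ∘ cong suc)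

-- Every triangle is counted once, at its vertex of least index.
module TriangleCount {n} (G : Graph n) (triangle : ∀ v → Neighbourhood.InTriangle G v) where
  open Neighbourhood G

  least : Fin n → ℕ
  least v = 𝟙 (does (isLocalMin? v))

  least-triangle : ∀ {w a b} → Adj w a → Adj w b → a ≢ b →
                   least w ≡ 𝟙 ((toℕ w <ᵇ toℕ a) ∧ (toℕ w <ᵇ toℕ b))
  least-triangle {w} w~a w~b a≢b with triangle w
  ... | _ , _ , N , _ = cong 𝟙 (isLocalMin-neighbourhood (neighbourhood-reorder N w~a w~b a≢b))

  seen-from-neighbours : ∀ u → ∑[ v < n ] (least u * 𝟙 (adj G v u)) ≡ 2 * least u
  seen-from-neighbours u with triangle u
  ... | _ , _ , N , _ = begin
    ∑[ v < n ] (least u * 𝟙 (adj G v u)) ≡⟨ sum-distribˡ-* (least u) (λ v → 𝟙 (adj G v u)) ⟩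
    least u * ∑[ v < n ] 𝟙 (adj G v u)   ≡⟨ cong (least u *_) (trans (degree-sym u) (degree-neighbourhood N)) ⟩
    least u * 2                          ≡⟨ *-comm (least u) 2 ⟩
    2 * least u                          ∎
    where open ≡-Reasoning

  one-least-per-triangle : ∀ v → least v + ∑[ u < n ] (least u * 𝟙 (adj G v u)) ≡ 1
  one-least-per-triangle v with triangle v
  ... | p , q , N@(p≢q , v~p , v~q , N⊆pq) , p~q = begin
    least v + ∑[ u < n ] (least u * 𝟙 (adj G v u))
      ≡⟨ cong (least v +_) (sum-pair p≢q (λ t t≢p t≢q →
           trans (cong (λ b → least t * 𝟙 b) (adj≡false (λ v~t → [ t≢p , t≢q ]′ (N⊆pq t v~t))))
                 (*-zeroʳ (least t)))) ⟩
    least v + (least p * 𝟙 (adj G v p) + least q * 𝟙 (adj G v q))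
      ≡⟨ cong₂ (λ a b → least v + (least p * 𝟙 a + least q * 𝟙 b)) (adj≡true v~p) (adj≡true v~q) ⟩
    least v + (least p * 1 + least q * 1)
      ≡⟨ cong₂ (λ a b → least v + (a + b)) (*-identityʳ (least p)) (*-identityʳ (least q)) ⟩
    least v + (least p + least q)
      ≡⟨ cong₂ _+_ (least-triangle v~p v~q p≢q)
                   (cong₂ _+_ (least-triangle (Adj-sym v~p) p~q (Adj⇒≢ v~q))
                              (least-triangle (Adj-sym v~q) (Adj-sym p~q) (Adj⇒≢ v~p))) ⟩
    𝟙 ((toℕ v <ᵇ toℕ p) ∧ (toℕ v <ᵇ toℕ q)) +
      (𝟙 ((toℕ p <ᵇ toℕ v) ∧ (toℕ p <ᵇ toℕ q)) + 𝟙 ((toℕ q <ᵇ toℕ v) ∧ (toℕ q <ᵇ toℕ p)))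
      ≡⟨ exactly-one-minimum (toℕ v) (toℕ p) (toℕ q)
           (Adj⇒≢ v~p ∘ toℕ-injective) (p≢q ∘ toℕ-injective) (Adj⇒≢ v~q ∘ toℕ-injective) ⟩
    1 ∎
    where open ≡-Reasoning

  3∣n : 3 ∣ n
  3∣n = divides (∑[ v < n ] least v) (begin
    n                                ≡⟨ sym (trans (sum-const n 1) (*-identityʳ n)) ⟩
    ∑[ v < n ] 1                     ≡⟨ sum-cong-≗ (λ v → sym (one-least-per-triangle v)) ⟩
    ∑[ v < n ] (least v + ∑[ u < n ] (least u * 𝟙 (adj G v u)))
      ≡⟨ sum-distrib-+ least (λ v → ∑[ u < n ] (least u * 𝟙 (adj G v u))) ⟩
    ∑[ v < n ] least v + ∑[ v < n ] ∑[ u < n ] (least u * 𝟙 (adj G v u))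
      ≡⟨ cong (∑[ v < n ] least v +_)
              (trans (sum-swap (λ v u → least u * 𝟙 (adj G v u))) (sum-cong-≗ seen-from-neighbours)) ⟩
    ∑[ v < n ] least v + ∑[ u < n ] (2 * least u)
      ≡⟨ cong (∑[ v < n ] least v +_) (sum-distribˡ-* 2 least) ⟩
    3 * ∑[ v < n ] least v           ≡⟨ *-comm 3 (∑[ v < n ] least v) ⟩
    ∑[ v < n ] least v * 3           ∎)
    where open ≡-Reasoning

module Charge {n} (H : Graph n) (free : P3Free H) where
  open Neighbourhood H

  no-P3 : ∀ {a b c d} → a ≢ c → a ≢ d → b ≢ d → Adj a b → Adj b c → Adj c d → ⊥
  no-P3 a≢c a≢d b≢d a~b b~c c~d =
    free (_ , _ , _ , _ , (Adj⇒≢ a~b , a≢c , a≢d , Adj⇒≢ b~c , b≢d , Adj⇒≢ c~d) , a~b , b~c , c~d)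

  -- 2 when v is a leaf hanging on u, 0 when u is a leaf hanging on v, and 1 when both or neither
  -- of v and u have other neighbours (a triangle edge or an isolated edge).
  share : Fin n → Fin n → ℕ
  share v u = 𝟙 (does (hasOtherNeighbour? u v)) + 𝟙 (not (does (hasOtherNeighbour? v u)))

  share+share≡2 : ∀ v u → share v u + share u v ≡ 2
  share+share≡2 v u = 𝟙+𝟙-not (does (hasOtherNeighbour? v u)) (does (hasOtherNeighbour? u v))

  share≤2 : ∀ v u → share v u ≤ 2
  share≤2 v u = 𝟙+𝟙≤2 (does (hasOtherNeighbour? u v)) _

  share-centre : ∀ {v u} → HasOtherNeighbour v u → ¬ HasOtherNeighbour u v → share v u ≡ 0
  share-centre {v} {u} v-other ¬u-other =
    cong₂ (λ a b → 𝟙 a + 𝟙 (not b)) (dec-false (hasOtherNeighbour? u v) ¬u-other)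
                                   (dec-true (hasOtherNeighbour? v u) v-other)

  share-isolated : ∀ {v u} → ¬ HasOtherNeighbour v u → ¬ HasOtherNeighbour u v → share v u ≡ 1
  share-isolated {v} {u} ¬v-other ¬u-other =
    cong₂ (λ a b → 𝟙 a + 𝟙 (not b)) (dec-false (hasOtherNeighbour? u v) ¬u-other)
                                   (dec-false (hasOtherNeighbour? v u) ¬v-other)

  share-triangle : ∀ {v u} → HasOtherNeighbour v u → HasOtherNeighbour u v → share v u ≡ 1
  share-triangle {v} {u} v-other u-other =
    cong₂ (λ a b → 𝟙 a + 𝟙 (not b)) (dec-true (hasOtherNeighbour? u v) u-other)
                                   (dec-true (hasOtherNeighbour? v u) v-other)

  received : Fin n → Fin n → ℕ
  received v u = if adj H v u then share v u else 0

  received-adj : ∀ {v u} → Adj v u → received v u ≡ share v u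
  received-adj {v} {u} v~u = cong (λ b → if b then share v u else 0) (adj≡true v~u)

  received-¬adj : ∀ {v u} → ¬ Adj v u → received v u ≡ 0
  received-¬adj {v} {u} ¬v~u = cong (λ b → if b then share v u else 0) (adj≡false ¬v~u)

  charge : Fin n → ℕ
  charge v = ∑[ u < n ] received v u

  2*edges≡∑charge : 2 * edges H ≡ ∑[ v < n ] charge v
  2*edges≡∑charge = 2*edges≡∑shares H share (λ v u _ → share+share≡2 v u)

  charge-isolated : ∀ {v} → (∀ t → ¬ Adj v t) → charge v ≡ 0
  charge-isolated isolated = sum-zero (λ t → received-¬adj (isolated t))

  charge-leaf : ∀ {v u} → Adj v u → OnlyNeighbour v u → charge v ≡ share v u
  charge-leaf v~u v-only =
    trans (sum-single _ (λ t t≢u → received-¬adj (t≢u ∘ v-only t))) (received-adj v~u)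

  charge-centre : ∀ {u v} → Adj u v → OnlyNeighbour v u → HasOtherNeighbour u v → charge u ≡ 0
  charge-centre {u} {v} u~v v-only (w , u~w , w≢v) = sum-zero received≡0
    where
    received≡0 : ∀ y → received u y ≡ 0
    received≡0 y with T? (adj H u y)
    ... | no ¬u~y = received-¬adj ¬u~y
    ... | yes u~y = trans (received-adj u~y) (share-centre u-other y-leaf)
      where
      u-other : HasOtherNeighbour u y
      u-other with y ≟ v
      ... | yes refl = w , u~w , w≢v
      ... | no  y≢v  = v , u~v , y≢v ∘ sym
      y-leaf : ¬ HasOtherNeighbour y u
      y-leaf (z , y~z , z≢u) with y ≟ v
      ... | yes refl = z≢u (v-only z y~z)
      ... | no  y≢v  = no-P3 z≢u z≢v y≢v (Adj-sym y~z) (Adj-sym u~y) u~v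
        where
        z≢v : z ≢ v
        z≢v refl = Adj⇒≢ u~y (sym (v-only y (Adj-sym y~z)))

  charge-triangle : ∀ {v p q} → NeighbourhoodIs v p q → Adj p q → charge v ≡ 2
  charge-triangle {p = p} {q} (p≢q , v~p , v~q , N⊆pq) p~q =
    trans (sum-pair p≢q (λ t t≢p t≢q → received-¬adj (λ v~t → [ t≢p , t≢q ]′ (N⊆pq t v~t))))
          (cong₂ _+_
            (trans (received-adj v~p) (share-triangle (q , v~q , p≢q ∘ sym) (q , p~q , Adj⇒≢ v~q ∘ sym)))
            (trans (received-adj v~q) (share-triangle (p , v~p , p≢q) (p , Adj-sym p~q , Adj⇒≢ v~p ∘ sym))))

  charge-cases : ∀ v → charge v ≡ 0 ⊎ (∃ λ u → Adj v u × OnlyNeighbour v u) ⊎ InTriangle v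
  charge-cases v with any? (λ u → T? (adj H v u))
  ... | no isolated = inj₁ (charge-isolated (λ t v~t → isolated (t , v~t)))
  ... | yes (u , v~u) with hasOtherNeighbour? v u
  ...   | no ¬v-other = inj₂ (inj₁ (u , v~u , ¬HasOther⇒Only ¬v-other))
  ...   | yes v-other@(w , v~w , w≢u) with hasOtherNeighbour? u v
  ...     | no ¬u-other = inj₁ (charge-centre v~u (¬HasOther⇒Only ¬u-other) v-other)
  ...     | yes (z , u~z , z≢v) = inj₂ (inj₂ (u , z , (Adj⇒≢ u~z , v~u , v~z , N⊆uz) , u~z))
    where
    N⊆uz : ∀ t → Adj v t → t ≡ u ⊎ t ≡ z
    N⊆uz t v~t with t ≟ u | t ≟ z
    ... | yes t≡u | _       = inj₁ t≡u
    ... | no _    | yes t≡z = inj₂ t≡z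
    ... | no t≢u  | no t≢z  =
      ⊥-elim (no-P3 z≢v (t≢z ∘ sym) (t≢u ∘ sym) (Adj-sym u~z) (Adj-sym v~u) v~t)
    v~z : Adj v z
    v~z with N⊆uz w v~w
    ... | inj₁ w≡u  = contradiction w≡u w≢u
    ... | inj₂ refl = v~w

  charge≤2 : ∀ v → charge v ≤ 2
  charge≤2 v with charge-cases v
  ... | inj₁ charge≡0                 = ≤-trans (≤-reflexive charge≡0) z≤n
  ... | inj₂ (inj₁ (u , v~u , v-only)) = ≤-trans (≤-reflexive (charge-leaf v~u v-only)) (share≤2 v u)
  ... | inj₂ (inj₂ (p , q , N , p~q))  = ≤-reflexive (charge-triangle N p~q)

  charge-pair≤2 : ∀ {w v} → OnlyNeighbour w v → charge w + charge v ≤ 2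
  charge-pair≤2 {w} {v} w-only with T? (adj H w v)
  ... | no ¬w~v =
    subst (λ x → x + charge v ≤ 2)
          (sym (charge-isolated (λ t w~t → ¬w~v (subst (Adj w) (w-only t w~t) w~t))))
          (charge≤2 v)
  ... | yes w~v with hasOtherNeighbour? v w
  ...   | yes v-other =
    subst (λ x → charge w + x ≤ 2) (sym (charge-centre (Adj-sym w~v) w-only v-other))
          (≤-trans (≤-reflexive (+-identityʳ (charge w))) (charge≤2 w))
  ...   | no ¬v-other = ≤-reflexive (begin
    charge w + charge v                 ≡⟨ cong₂ _+_ (charge-leaf w~v w-only)
                                                     (charge-leaf (Adj-sym w~v) (¬HasOther⇒Only ¬v-other)) ⟩
    share w v + share v w               ≡⟨ share+share≡2 w v ⟩
    2                                   ∎)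
    where open ≡-Reasoning

  charge≡2⇒InTriangle : (∀ v → charge v ≡ 2) → ∀ v → InTriangle v
  charge≡2⇒InTriangle charge≡2 v with charge-cases v
  ... | inj₁ charge≡0 = contradiction (trans (sym (charge≡2 v)) charge≡0) λ ()
  ... | inj₂ (inj₂ triangle) = triangle
  ... | inj₂ (inj₁ (u , v~u , v-only)) with hasOtherNeighbour? u v
  ...   | yes u-other =
    contradiction (trans (sym (charge≡2 u)) (charge-centre (Adj-sym v~u) v-only u-other)) λ ()
  ...   | no ¬u-other =
    contradiction (trans (sym (charge≡2 v))
                         (trans (charge-leaf v~u v-only) (share-isolated ¬v-other ¬u-other))) λ ()
    where
    ¬v-other : ¬ HasOtherNeighbour v u
    ¬v-other (t , v~t , t≢u) = t≢u (v-only t v~t)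

  edges<n : ¬ 3 ∣ n → edges H < n
  edges<n 3∤n with ¬∀⟶∃¬ n (λ v → charge v ≡ 2) (λ v → charge v ≟ℕ 2)
                    (λ charge≡2 → 3∤n (TriangleCount.3∣n H (charge≡2⇒InTriangle charge≡2)))
  ... | v , charge≢2 = *-cancelˡ-< 2 (edges H) n (begin-strict
    2 * edges H          ≡⟨ 2*edges≡∑charge ⟩
    ∑[ u < n ] charge u  <⟨ sum<bound v charge≤2 (≤∧≢⇒< (charge≤2 v) charge≢2) ⟩
    n * 2                ≡⟨ *-comm n 2 ⟩
    2 * n                ∎)
    where open ≤-Reasoning

module _ {n} (G : Graph n) (o : Fin n) where

  star : Graph n
  star = record
    { adj    = λ x y → (⌊ x ≟ o ⌋ ∨ ⌊ y ≟ o ⌋) ∧ adj G x y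
    ; sym    = λ x y → cong₂ _∧_ (∨-comm ⌊ x ≟ o ⌋ ⌊ y ≟ o ⌋) (Graph.sym G x y)
    ; irrefl = λ x → trans (cong ((⌊ x ≟ o ⌋ ∨ ⌊ x ≟ o ⌋) ∧_) (irrefl G x)) (∧-zeroʳ _)
    }

  star⊑ : star ⊑ G
  star⊑ x y x~y = proj₂ (Equivalence.to (T-∧ {⌊ x ≟ o ⌋ ∨ ⌊ y ≟ o ⌋}) x~y)

  star-edge-at-centre : ∀ {x y} → T (adj star x y) → x ≡ o ⊎ y ≡ o
  star-edge-at-centre {x} {y} x~y
    with Equivalence.to (T-∨ {⌊ x ≟ o ⌋}) (proj₁ (Equivalence.to (T-∧ {⌊ x ≟ o ⌋ ∨ ⌊ y ≟ o ⌋}) x~y))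
  ... | inj₁ x≡o = inj₁ (toWitness x≡o)
  ... | inj₂ y≡o = inj₂ (toWitness y≡o)

  star-P3Free : P3Free star
  star-P3Free (a , b , c , d , (_ , a≢c , a≢d , b≢c , b≢d , _) , a~b , _ , c~d)
    with star-edge-at-centre a~b | star-edge-at-centre c~d
  ... | inj₁ a≡o | inj₁ c≡o = a≢c (trans a≡o (sym c≡o))
  ... | inj₁ a≡o | inj₂ d≡o = a≢d (trans a≡o (sym d≡o))
  ... | inj₂ b≡o | inj₁ c≡o = b≢c (trans b≡o (sym c≡o))
  ... | inj₂ b≡o | inj₂ d≡o = b≢d (trans b≡o (sym d≡o))

  degree-star : ∀ x → degree star x ≡ 𝟙 ⌊ x ≟ o ⌋ * degree G o + 𝟙 (adj G x o)
  degree-star x with x ≟ o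
  ... | yes refl =
    sym (trans (cong₂ _+_ (+-identityʳ (degree G x)) (cong 𝟙 (irrefl G x))) (+-identityʳ (degree G x)))
  ... | no x≢o =
    trans (sum-single o (λ y y≢o → cong (λ b → 𝟙 (b ∧ adj G x y)) (⌊⌋-false (y ≟ o) y≢o)))
          (cong (λ b → 𝟙 (b ∧ adj G x o)) (⌊⌋-true (o ≟ o) refl))

  edges-star : edges star ≡ degree G o
  edges-star = *-cancelˡ-≡ (edges star) (degree G o) 2 (begin
    2 * edges star                  ≡⟨ handshake star ⟩
    ∑[ x < n ] degree star x        ≡⟨ sum-cong-≗ degree-star ⟩
    ∑[ x < n ] (𝟙 ⌊ x ≟ o ⌋ * degree G o + 𝟙 (adj G x o))
                                    ≡⟨ sum-distrib-+ (λ x → 𝟙 ⌊ x ≟ o ⌋ * degree G o) (λ x → 𝟙 (adj G x o)) ⟩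
    ∑[ x < n ] (𝟙 ⌊ x ≟ o ⌋ * degree G o) + ∑[ x < n ] 𝟙 (adj G x o)
                                    ≡⟨ cong₂ _+_ centre (Neighbourhood.degree-sym G o) ⟩
    degree G o + degree G o         ≡⟨ cong (degree G o +_) (sym (+-identityʳ (degree G o))) ⟩
    2 * degree G o                  ∎)
    where
    open ≡-Reasoning
    centre : ∑[ x < n ] (𝟙 ⌊ x ≟ o ⌋ * degree G o) ≡ degree G o
    centre = begin
      ∑[ x < n ] (𝟙 ⌊ x ≟ o ⌋ * degree G o) ≡⟨ sum-cong-≗ (λ x → *-comm (𝟙 ⌊ x ≟ o ⌋) (degree G o)) ⟩
      ∑[ x < n ] (degree G o * 𝟙 ⌊ x ≟ o ⌋) ≡⟨ sum-distribˡ-* (degree G o) (λ x → 𝟙 ⌊ x ≟ o ⌋) ⟩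
      degree G o * ∑[ x < n ] 𝟙 ⌊ x ≟ o ⌋   ≡⟨ cong (degree G o *_) (sum-𝟙-≟ˡ o) ⟩
      degree G o * 1                        ≡⟨ *-identityʳ (degree G o) ⟩
      degree G o                            ∎

2*[1+m]C2 : ∀ m → 2 * (suc m C 2) ≡ suc m * m
2*[1+m]C2 zero    = refl
2*[1+m]C2 (suc m) = begin
  2 * (suc (suc m) C 2)             ≡⟨ cong (2 *_) (sym (nCk+nC[k+1]≡[n+1]C[k+1] (suc m) 1)) ⟩
  2 * (suc m C 1 + suc m C 2)       ≡⟨ *-distribˡ-+ 2 (suc m C 1) (suc m C 2) ⟩
  2 * (suc m C 1) + 2 * (suc m C 2) ≡⟨ cong₂ (λ a b → 2 * a + b) (nC1≡n (suc m)) (2*[1+m]C2 m) ⟩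
  2 * suc m + suc m * m             ≡⟨ solve 1 (λ m → con 2 :* (con 1 :+ m) :+ (con 1 :+ m) :* m
                                                   := (con 2 :+ m) :* (con 1 :+ m)) refl m ⟩
  suc (suc m) * suc m               ∎
  where open ≡-Reasoning

module _ {m s} (f : Fin m → Fin s) where

  adj-core-core : ∀ j t → adj (Pendant m s f) (j ↑ˡ s) (t ↑ˡ s) ≡ not ⌊ j ≟ t ⌋
  adj-core-core j t rewrite splitAt-↑ˡ m j s | splitAt-↑ˡ m t s = refl

  adj-core-pendant : ∀ j i → adj (Pendant m s f) (j ↑ˡ s) (m ↑ʳ i) ≡ ⌊ f j ≟ i ⌋
  adj-core-pendant j i rewrite splitAt-↑ˡ m j s | splitAt-↑ʳ m s i = refl

  adj-pendant-core : ∀ i j → adj (Pendant m s f) (m ↑ʳ i) (j ↑ˡ s) ≡ ⌊ f j ≟ i ⌋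
  adj-pendant-core i j rewrite splitAt-↑ʳ m s i | splitAt-↑ˡ m j s = refl

  adj-pendant-pendant : ∀ i i′ → adj (Pendant m s f) (m ↑ʳ i) (m ↑ʳ i′) ≡ false
  adj-pendant-pendant i i′ rewrite splitAt-↑ʳ m s i | splitAt-↑ʳ m s i′ = refl

  pendant-neighbour : ∀ i x → T (adj (Pendant m s f) (m ↑ʳ i) x) → ∃ λ j → x ≡ j ↑ˡ s × f j ≡ i
  pendant-neighbour i x i~x rewrite splitAt-↑ʳ m s i with splitAt m x in split-x
  ... | inj₁ j = j , sym (splitAt⁻¹-↑ˡ split-x) , toWitness i~x

  fiberSize≡∑ : ∀ i → fiberSize f i ≡ ∑[ j < m ] 𝟙 ⌊ f j ≟ i ⌋
  fiberSize≡∑ i = Σ≡∑ m (λ j → 𝟙 ⌊ f j ≟ i ⌋)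

  sum-fiberSize : ∀ (g : Fin s → ℕ) → ∑[ i < s ] (fiberSize f i * g i) ≡ ∑[ j < m ] g (f j)
  sum-fiberSize g = begin
    ∑[ i < s ] (fiberSize f i * g i)
      ≡⟨ sum-cong-≗ (λ i → trans (cong (_* g i) (fiberSize≡∑ i)) (*-comm _ (g i))) ⟩
    ∑[ i < s ] (g i * ∑[ j < m ] 𝟙 ⌊ f j ≟ i ⌋)
      ≡⟨ sum-cong-≗ (λ i → sym (sum-distribˡ-* (g i) (λ j → 𝟙 ⌊ f j ≟ i ⌋))) ⟩
    ∑[ i < s ] ∑[ j < m ] (g i * 𝟙 ⌊ f j ≟ i ⌋)
      ≡⟨ sum-swap (λ i j → g i * 𝟙 ⌊ f j ≟ i ⌋) ⟩
    ∑[ j < m ] ∑[ i < s ] (g i * 𝟙 ⌊ f j ≟ i ⌋)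
      ≡⟨ sum-cong-≗ only-f-j-counts ⟩
    ∑[ j < m ] g (f j) ∎
    where
    open ≡-Reasoning
    only-f-j-counts : ∀ j → ∑[ i < s ] (g i * 𝟙 ⌊ f j ≟ i ⌋) ≡ g (f j)
    only-f-j-counts j = begin
      ∑[ i < s ] (g i * 𝟙 ⌊ f j ≟ i ⌋)
        ≡⟨ sum-single (f j) (λ i i≢fj →
             trans (cong (λ b → g i * 𝟙 b) (⌊⌋-false (f j ≟ i) (i≢fj ∘ sym))) (*-zeroʳ (g i))) ⟩
      g (f j) * 𝟙 ⌊ f j ≟ f j ⌋ ≡⟨ cong (λ b → g (f j) * 𝟙 b) (⌊⌋-true (f j ≟ f j) refl) ⟩
      g (f j) * 1               ≡⟨ *-identityʳ (g (f j)) ⟩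
      g (f j)                   ∎

  degree-core : ∀ j → degree (Pendant m s f) (j ↑ˡ s) ≡ m
  degree-core j = begin
    degree (Pendant m s f) (j ↑ˡ s)
      ≡⟨ sum-↑ m (λ x → 𝟙 (adj (Pendant m s f) (j ↑ˡ s) x)) ⟩
    ∑[ t < m ] 𝟙 (adj (Pendant m s f) (j ↑ˡ s) (t ↑ˡ s)) +
    ∑[ i < s ] 𝟙 (adj (Pendant m s f) (j ↑ˡ s) (m ↑ʳ i))
      ≡⟨ cong₂ _+_ (sum-cong-≗ (λ t → cong 𝟙 (adj-core-core j t)))
                   (sum-cong-≗ (λ i → cong 𝟙 (adj-core-pendant j i))) ⟩
    ∑[ t < m ] 𝟙 (not ⌊ j ≟ t ⌋) + ∑[ i < s ] 𝟙 ⌊ f j ≟ i ⌋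
      ≡⟨ cong (∑[ t < m ] 𝟙 (not ⌊ j ≟ t ⌋) +_) (trans (sum-𝟙-≟ʳ (f j)) (sym (sum-𝟙-≟ʳ j))) ⟩
    ∑[ t < m ] 𝟙 (not ⌊ j ≟ t ⌋) + ∑[ t < m ] 𝟙 ⌊ j ≟ t ⌋
      ≡⟨ sym (sum-distrib-+ (λ t → 𝟙 (not ⌊ j ≟ t ⌋)) (λ t → 𝟙 ⌊ j ≟ t ⌋)) ⟩
    ∑[ t < m ] (𝟙 (not ⌊ j ≟ t ⌋) + 𝟙 ⌊ j ≟ t ⌋)
      ≡⟨ sum-cong-≗ (λ t → 𝟙-not+𝟙 ⌊ j ≟ t ⌋) ⟩
    ∑[ t < m ] 1
      ≡⟨ trans (sum-const m 1) (*-identityʳ m) ⟩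
    m ∎
    where open ≡-Reasoning

  degree-pendant : ∀ i → degree (Pendant m s f) (m ↑ʳ i) ≡ fiberSize f i
  degree-pendant i = begin
    degree (Pendant m s f) (m ↑ʳ i)
      ≡⟨ sum-↑ m (λ x → 𝟙 (adj (Pendant m s f) (m ↑ʳ i) x)) ⟩
    ∑[ t < m ] 𝟙 (adj (Pendant m s f) (m ↑ʳ i) (t ↑ˡ s)) +
    ∑[ i′ < s ] 𝟙 (adj (Pendant m s f) (m ↑ʳ i) (m ↑ʳ i′))
      ≡⟨ cong₂ _+_ (sum-cong-≗ (λ t → cong 𝟙 (adj-pendant-core i t)))
                   (sum-zero (λ i′ → cong 𝟙 (adj-pendant-pendant i i′))) ⟩
    ∑[ t < m ] 𝟙 ⌊ f t ≟ i ⌋ + 0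
      ≡⟨ trans (+-identityʳ _) (sym (fiberSize≡∑ i)) ⟩
    fiberSize f i ∎
    where open ≡-Reasoning

  edges-Pendant : edges (Pendant m s f) ≡ suc m C 2
  edges-Pendant = *-cancelˡ-≡ (edges (Pendant m s f)) (suc m C 2) 2 (begin
    2 * edges (Pendant m s f)
      ≡⟨ handshake (Pendant m s f) ⟩
    ∑[ x < m + s ] degree (Pendant m s f) x
      ≡⟨ sum-↑ m (degree (Pendant m s f)) ⟩
    ∑[ j < m ] degree (Pendant m s f) (j ↑ˡ s) + ∑[ i < s ] degree (Pendant m s f) (m ↑ʳ i)
      ≡⟨ cong₂ _+_ (sum-cong-≗ degree-core)
                   (sum-cong-≗ (λ i → trans (degree-pendant i) (sym (*-identityʳ (fiberSize f i))))) ⟩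
    ∑[ j < m ] m + ∑[ i < s ] (fiberSize f i * 1)
      ≡⟨ cong₂ _+_ (sum-const m m)
                   (trans (sum-fiberSize (λ _ → 1)) (trans (sum-const m 1) (*-identityʳ m))) ⟩
    m * m + m
      ≡⟨ +-comm (m * m) m ⟩
    suc m * m
      ≡⟨ sym (2*[1+m]C2 m) ⟩
    2 * (suc m C 2) ∎)
    where open ≡-Reasoning

  fiberSize≡1⇒injective : (∀ i → fiberSize f i ≡ 1) → Injective _≡_ _≡_ f
  fiberSize≡1⇒injective fiber≡1 {j} {j′} fj≡fj′ with j ≟ j′
  ... | yes j≡j′ = j≡j′
  ... | no  j≢j′ = contradiction (begin
    2                                  ≡⟨ sym (cong₂ (λ a b → 𝟙 a + 𝟙 b) (⌊⌋-true (f j ≟ f j) refl)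
                                                                       (⌊⌋-true (f j′ ≟ f j) (sym fj≡fj′))) ⟩
    𝟙 ⌊ f j ≟ f j ⌋ + 𝟙 ⌊ f j′ ≟ f j ⌋ ≤⟨ pair≤sum (λ t → 𝟙 ⌊ f t ≟ f j ⌋) j≢j′ ⟩
    ∑[ t < m ] 𝟙 ⌊ f t ≟ f j ⌋         ≡⟨ sym (fiberSize≡∑ (f j)) ⟩
    fiberSize f (f j)                  ≡⟨ fiber≡1 (f j) ⟩
    1                                  ∎) (n≮n 1)
    where open ≤-Reasoning

  Pendant-ex≥ : Fin m → ExP3≥ (Pendant m s f) m
  Pendant-ex≥ j = star P (j ↑ˡ s) , star⊑ P (j ↑ˡ s) , star-P3Free P (j ↑ˡ s) ,
                  ≤-reflexive (sym (trans (edges-star P (j ↑ˡ s)) (degree-core j)))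
    where
    P : Graph (m + s)
    P = Pendant m s f

  Pendant-ex≤-singletons : (∀ i → fiberSize f i ≡ 1) → ExP3≤ (Pendant m s f) m
  Pendant-ex≤-singletons fiber≡1 H H⊑P free = *-cancelˡ-≤ 2 (begin
    2 * edges H
      ≡⟨ 2*edges≡∑charge ⟩
    ∑[ x < m + s ] charge x
      ≡⟨ sum-↑ m charge ⟩
    ∑[ j < m ] charge (j ↑ˡ s) + ∑[ i < s ] charge (m ↑ʳ i)
      ≡⟨ cong (∑[ j < m ] charge (j ↑ˡ s) +_) pendants ⟩
    ∑[ j < m ] charge (j ↑ˡ s) + ∑[ j < m ] charge (m ↑ʳ f j)
      ≡⟨ sym (sum-distrib-+ (λ j → charge (j ↑ˡ s)) (λ j → charge (m ↑ʳ f j))) ⟩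
    ∑[ j < m ] (charge (j ↑ˡ s) + charge (m ↑ʳ f j))
      ≤⟨ sum-mono-≤ pair≤2 ⟩
    ∑[ j < m ] 2
      ≡⟨ trans (sum-const m 2) (*-comm m 2) ⟩
    2 * m ∎)
    where
    open Charge H free
    open Neighbourhood H using (OnlyNeighbour)
    open ≤-Reasoning
    pendants : ∑[ i < s ] charge (m ↑ʳ i) ≡ ∑[ j < m ] charge (m ↑ʳ f j)
    pendants = trans (sum-cong-≗ (λ i → sym (trans (cong (_* charge (m ↑ʳ i)) (fiber≡1 i))
                                                   (+-identityʳ (charge (m ↑ʳ i))))))
                     (sum-fiberSize (λ i → charge (m ↑ʳ i)))
    pendant-leaf : ∀ j → OnlyNeighbour (m ↑ʳ f j) (j ↑ˡ s)
    pendant-leaf j x fj~x with pendant-neighbour (f j) x (H⊑P _ _ fj~x)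
    ... | j′ , refl , fj′≡fj = cong (_↑ˡ s) (fiberSize≡1⇒injective fiber≡1 fj′≡fj)
    pair≤2 : ∀ j → charge (j ↑ˡ s) + charge (m ↑ʳ f j) ≤ 2
    pair≤2 j = subst (_≤ 2) (+-comm (charge (m ↑ʳ f j)) _) (charge-pair≤2 (pendant-leaf j))

ExP3≤-3∤order : ∀ {m} (G : Graph (m + 1)) → ¬ 3 ∣ suc m → ExP3≤ G m
ExP3≤-3∤order {m} G 3∤1+m H _ free = m<1+n⇒m≤n (subst (edges H <_) (+-comm m 1)
  (Charge.edges<n H free (3∤1+m ∘ subst (3 ∣_) (+-comm m 1))))

Pendant-ex≤-one-block : ∀ {m s} (r : Fin s → ℕ) → (∀ i → 1 ≤ r i) → Σ[ s ] r ≡ m →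
                        (f : Fin m → Fin s) → ¬ 3 ∣ suc m → (∃ λ i → toℕ i ≡ 0 × r i ≡ m) →
                        ExP3≤ (Pendant m s f) m
Pendant-ex≤-one-block {s = zero}        _ _   _    _ _     (() , _)
Pendant-ex≤-one-block {s = suc zero}    _ _   _    f 3∤1+m _ = ExP3≤-3∤order (Pendant _ 1 f) 3∤1+m
Pendant-ex≤-one-block {s = suc (suc s)} _ _   _    _ _     (suc i , () , _)
Pendant-ex≤-one-block {m} {suc (suc s)} r r≥1 ∑r≡m _ _     (zero , _ , r₀≡m) =
  contradiction m<m (n≮n m)
  where
  open ≤-Reasoning
  m<m : m < m
  m<m = begin-strict
    m                                    ≡⟨ sym r₀≡m ⟩
    r zero                               <⟨ m<m+n (r zero) (r≥1 (suc zero)) ⟩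
    r zero + r (suc zero)                ≤⟨ +-monoʳ-≤ (r zero) (m≤m+n (r (suc zero)) _) ⟩
    ∑[ i < suc (suc s) ] r i             ≡⟨ trans (sym (Σ≡∑ (suc (suc s)) r)) ∑r≡m ⟩
    m                                    ∎

lemma3p13 : (k : ℕ) → 4 ≤ k →
    ((s : ℕ) (r : Fin s → ℕ) → (∀ i → 1 ≤ r i) → Σ[ s ] r ≡ k ∸ 1 →
      (f : Fin (k ∸ 1) → Fin s) → (∀ i → fiberSize f i ≡ r i) →
        ExP3≥ (Pendant (k ∸ 1) s f) (k ∸ 1)
        × ((∀ i → r i ≡ 1) → ExP3≡ (Pendant (k ∸ 1) s f) (k ∸ 1))
        × (¬ (3 ∣ k) → (∃[ i ] (toℕ i ≡ 0 × r i ≡ k ∸ 1)) →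
            ExP3≡ (Pendant (k ∸ 1) s f) (k ∸ 1)))
    × (∃[ n ] Σ (Graph n) λ G →
        (∀ H → H ⊑ G → P3Free H → edges H < k) × k C 2 ≤ edges G)
lemma3p13 (suc (suc m′)) (s≤s (s≤s _)) =
  (λ s r r≥1 ∑r≡m f fiber≡r →
     Pendant-ex≥ f zero ,
     (λ r≡1 → Pendant-ex≥ f zero , Pendant-ex≤-singletons f (λ i → trans (fiber≡r i) (r≡1 i))) ,
     (λ 3∤k one-block → Pendant-ex≥ f zero , Pendant-ex≤-one-block r r≥1 ∑r≡m f 3∤k one-block)) ,
  (m + m , Pendant m m id ,
   (λ H H⊑G free → s≤s (Pendant-ex≤-singletons id singletons H H⊑G free)) ,
   ≤-reflexive (sym (edges-Pendant {m} id)))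
  where
  m : ℕ
  m = suc m′
  singletons : ∀ i → fiberSize {m} id i ≡ 1
  singletons i = trans (fiberSize≡∑ id i) (sum-𝟙-≟ˡ i)
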